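{- Let $n\ge2$, let $p$ be a prime, let $\phi$ be a Maass form for $\mathrm{SL}(n,\mathbb Z)$ normalized so that $A_\phi(1,\ldots,1)=1$, and let $K_1,\ldots,K_{n-1}\in\mathbb Z_{\ge0}$. Then $A_\phi(p^{K_1},p^{K_2},\ldots,p^{K_{n-1}})\in\mathcal H_p^*$, i.e. there is an element $T$ of the Hecke algebra $\mathcal H_p$ with $T\phi=A_\phi(p^{K_1},\ldots,p^{K_{n-1}})\,\phi$.
   Context: A Maass form $\phi$ for $\mathrm{SL}(n,\mathbb Z)$ is a smooth function on $\mathfrak h^n=\mathrm{GL}(n,\mathbb R)/(\mathrm O(n,\mathbb R)\cdot\mathbb R^\times)$, automorphic for $\mathrm{SL}(n,\mathbb Z)$, of moderate growth, and a joint eigenfunction of the invariant differential operators and of the Hecke operators; $A_\phi(m_1,\ldots,m_{n-1})$ ($m_1,\ldots,m_{n-2}\ge1$, $m_{n-1}\ne0$) denote its arithmetic Fourier coefficients in its Fourier–Whittaker expansion. For each positive integer $m$ there is a Hecke operator $T_m$ acting on Maass forms with $T_m\phi=A_\phi(m,1,\ldots,1)\phi$. For a prime $p$, $\mathcal H_p$ is the polynomial ring over $\mathbb Z$ generated by the operators $T_{p^k}$, $k\ge0$, and $\mathcal H_p^*$ is the set of eigenvalues on $\phi$ of elements of $\mathcal H_p$. The coefficients satisfy the known Hecke relation: for every positive integer $m$, $$A_\phi(m,1,\ldots,1)A_\phi(m_1,\ldots,m_{n-1})=\sum_{\substack{c_1\cdots c_n=m\\ c_i\mid m_i\ (1\le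 i\le n-1)}}A_\phi\Big(\frac{m_1c_n}{c_1},\frac{m_2c_1}{c_2},\ldots,\frac{m_{n-1}c_{n-2}}{c_{n-1}}\Big).$$ -}

module Defs where

open import Level using (Level)
open import Data.Nat using (ℕ; zero; suc; _^_; _≤_; _/_)
import Data.Nat as ℕ
open import Data.Nat.Divisibility using (_∣_; _∣?_)
open import Data.Nat.Primality using (Prime)
open import Data.Integer using (ℤ; +_; -[1+_])
open import Data.Fin using (Fin; inject₁; fromℕ)
import Data.Fin as F
open import Data.Fin.Properties using (all?)
open import Data.Vec using (Vec; []; _∷_; lookup; replicate; foldr)
open import Data.List using (List; [_]; concatMap; map; upTo; filter)
import Data.List as L
open import Data.Product using (_×_; Σ)
open import Relation.Nullary using (Dec)
open import Relation.Nullary.Decidable using (_×-dec_)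
open import Relation.Binary.PropositionalEquality using (_≡_)
open import Algebra.Bundles using (CommutativeRing)

-- total natural division (only ever used with nonzero divisor)
_div_ : ℕ → ℕ → ℕ
m div zero    = zero
m div (suc d) = m / suc d

vprod : ∀ {l} → Vec ℕ l → ℕ
vprod = foldr _ ℕ._*_ 1

vecs : (l m : ℕ) → List (Vec ℕ l)
vecs zero    m = [ [] ]
vecs (suc l) m = concatMap (λ x → map (x ∷_) (vecs l m)) (map suc (upTo m))

-- For Fourier coefficients with n = k + 2, index tuples (m_1,…,m_{n-1})
-- are vectors of length k+1; tuples (c_1,…,c_n) have length k+2.

HeckeCond : ∀ k → ℕ → Vec ℕ (suc k) → Vec ℕ (suc (suc k)) → Set
HeckeCond k m ms c = (vprod c ≡ m) × (∀ (i : Fin (suc k)) → lookup c (inject₁ i) ∣ lookup ms i)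

heckeCond? : ∀ k m ms c → Dec (HeckeCond k m ms c)
heckeCond? k m ms c = (vprod c ℕ.≟ m) ×-dec all? (λ i → lookup c (inject₁ i) ∣? lookup ms i)

-- index c_{i-1} (cyclically, c_0 := c_n) for the i-th new argument
prevIdx : ∀ {k} → Fin (suc k) → Fin (suc (suc k))
prevIdx {k} F.zero = fromℕ (suc k)
prevIdx (F.suc j)  = inject₁ (inject₁ j)

shifted : ∀ {k} → Vec ℕ (suc k) → Vec ℕ (suc (suc k)) → Vec ℕ (suc k)
shifted {k} ms c = Data.Vec.tabulate λ i →
  (lookup ms i ℕ.* lookup c (prevIdx i)) div lookup c (inject₁ i)

first : ∀ k → ℕ → Vec ℕ (suc k)
first k m = m ∷ replicate k 1

-- Integer polynomial expressions in the generators T_{p^j}, j ≥ 0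
-- (elements of the Hecke algebra H_p as words in the generators)
data HExpr : Set where
  con : ℤ → HExpr
  gen : ℕ → HExpr
  _⊕_ : HExpr → HExpr → HExpr
  _⊗_ : HExpr → HExpr → HExpr

module _ {c ℓ : Level} (R : CommutativeRing c ℓ) where
  open CommutativeRing R

  ℕ→R : ℕ → Carrier
  ℕ→R zero    = 0#
  ℕ→R (suc n) = 1# + ℕ→R n

  ℤ→R : ℤ → Carrier
  ℤ→R (+ n)     = ℕ→R n
  ℤ→R -[1+ n ]  = - ℕ→R (suc n)

  rsum : List Carrier → Carrier
  rsum = L.foldr _+_ 0#

  HeckeRelation : ∀ k → (Vec ℕ (suc k) → Carrier) → Set _
  HeckeRelation k A =
    ∀ (m : ℕ) (ms : Vec ℕ (suc k)) → 1 ≤ m → (∀ i → 1 ≤ lookup ms i) →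
      A (first k m) * A ms ≈
        rsum (map (λ cs → A (shifted ms cs))
                  (filter (heckeCond? k m ms) (vecs (suc (suc k)) m)))

  -- eigenvalue of an element of H_p: T_{p^j} acts by A(p^j,1,…,1)
  evalH : ∀ k → (Vec ℕ (suc k) → Carrier) → ℕ → HExpr → Carrier
  evalH k A p (con z) = ℤ→R z
  evalH k A p (gen j) = A (first k (p ^ j))
  evalH k A p (e ⊕ f) = evalH k A p e + evalH k A p f
  evalH k A p (e ⊗ f) = evalH k A p e * evalH k A p f

  InHp* : ∀ k → (Vec ℕ (suc k) → Carrier) → ℕ → Carrier → Set _
  InHp* k A p x = Σ HExpr λ T → evalH k A p T ≈ x

module Submission where

-- Induction on K along the colexicographic order (last coordinate most significant). For
-- K = (K₁, K′) ≠ 0 put M = (K′, 0) and apply the Hecke relation with m = p^(K₁ + ⋯ + K_{n-1}) and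
-- (m_i) = p^M. Every c in the sum is a vector of p-powers p^b with b_i ≤ M_i, and contributes
-- A(p^e) with e_i = M_i + b_{i-1} − b_i (b_0 := b_n). The vector c* = (p^M, p^K₁) gives e = K and
-- occurs once; for every other c, comparing from the last coordinate (where M_{n-1} = 0 forces
-- b_{n-1} = 0) gives e <colex K. As M <colex K as well, A(p^K) = T_m A(p^M) − Σ_{c ≠ c*} A(p^e) lies
-- in H_p^* by induction. A lexicographic order is needed: the weight Σ i e_i is the same for all terms.

open import Defs
open import Level using (Level; 0ℓ)
open import Algebra.Bundles using (CommutativeRing)
open import Data.Empty using (⊥)
open import Data.Fin using (inject₁; fromℕ) renaming (zero to fzero; suc to fsuc)
import Data.Integer as ℤ
open import Data.List using (List; []; _∷_; filter; upTo)
import Data.List as List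
open import Data.List.Membership.Propositional using (_∈_)
open import Data.List.Membership.Propositional.Properties
  using (∈-map⁺; ∈-map⁻; ∈-concat⁺′; ∈-upTo⁺; ∈-filter⁺; ∈-filter⁻)
open import Data.List.Relation.Binary.Disjoint.Propositional using (Disjoint)
open import Data.List.Relation.Unary.Any using (here; there)
import Data.List.Relation.Unary.All as All
import Data.List.Relation.Unary.All.Properties as All
import Data.List.Relation.Unary.AllPairs as AllPairs
import Data.List.Relation.Unary.AllPairs.Properties as AllPairs
open import Data.List.Relation.Unary.Unique.Propositional using (Unique)
import Data.List.Relation.Unary.Unique.Propositional.Properties as Unique
open import Data.Nat using (ℕ; zero; suc; _+_; _*_; _∸_; _^_; _≤_; _<_; z<s; NonZero; _/_;
  ≢-nonZero⁻¹; nonTrivial⇒n>1)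
open import Data.Nat.Properties
  using (*-comm; *-assoc; +-comm; +-assoc; +-cancelˡ-≡; ≤-refl; ≤-trans; ≤-antisym; ≮⇒≥; <⇒≱; m≤m+n;
         m≤n⇒m<n∨m≡n; n≤0⇒n≡0; suc-injective; m∸n+n≡m; m+n∸m≡n; ^-distribˡ-+-*; ^-monoʳ-<; m^n≢0; m^n>0)
open import Data.Nat.DivMod using (m*n/n≡m)
open import Data.Nat.Divisibility
  using (_∣_; divides; ∣-reflexive; ∣1⇒≡1; ∣⇒≤; 0∣⇒≡0; m*n∣⇒m∣; m*n∣⇒n∣; *-cancelˡ-∣; *-cancelʳ-∣)
open import Data.Nat.Induction using (<-wellFounded)
open import Data.Nat.Primality using (Prime; euclidsLemma; prime⇒nonZero; prime⇒nonTrivial)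
open import Data.Product using (_×_; _,_; proj₁; proj₂; ∃-syntax)
open import Data.Product.Relation.Binary.Lex.Strict using (×-Lex; ×-wellFounded)
open import Data.Sum using (_⊎_; inj₁; inj₂)
open import Data.Vec using (Vec; []; _∷_; _∷ʳ_; map; lookup; replicate; sum; head; tail; initLast)
open import Data.Vec.Properties
  using (lookup-map; map-replicate; tabulate-cong; tabulate∘lookup; ∷-injectiveˡ; ∷-injectiveʳ)
open import Function using (_∘_; _on_)
open import Induction.WellFounded using (WellFounded; acc)
import Induction.WellFounded as WF
open import Relation.Binary using (Rel)
import Relation.Binary.Construct.On as On
open import Relation.Binary.PropositionalEquality
  using (_≡_; _≢_; refl; sym; trans; cong; cong₂; subst; subst₂; ≢-sym; module ≡-Reasoning)
open import Relation.Nullary using (contradiction)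

private variable
  l : ℕ

module _ {p : ℕ} (p-prime : Prime p) where
  private instance
    p≢0 : NonZero p
    p≢0 = prime⇒nonZero p-prime

  ∣p^n⇒≡p^i : ∀ n {x} → x ∣ p ^ n → ∃[ i ] x ≡ p ^ i
  ∣p^n⇒≡p^i zero    x∣1 = 0 , ∣1⇒≡1 x∣1
  ∣p^n⇒≡p^i (suc n) {x} (divides q p^[1+n]≡q*x)
    with euclidsLemma q x p-prime (divides (p ^ n) (trans (sym p^[1+n]≡q*x) (*-comm p (p ^ n))))
  ... | inj₁ (divides r refl) =
    ∣p^n⇒≡p^i n (*-cancelˡ-∣ p (divides r (trans p^[1+n]≡q*x (*-assoc r p x))))
  ... | inj₂ (divides y refl) =
    let i , y≡p^i = ∣p^n⇒≡p^i n
                      (*-cancelʳ-∣ {y} {p ^ n} p (divides q (trans (*-comm (p ^ n) p) p^[1+n]≡q*x)))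
    in suc i , trans (cong (_* p) y≡p^i) (*-comm (p ^ i) p)

  p^i∣p^j⇒i≤j : ∀ {i j} → p ^ i ∣ p ^ j → i ≤ j
  p^i∣p^j⇒i≤j {i} {j} p^i∣p^j = ≮⇒≥ λ j<i →
    <⇒≱ (^-monoʳ-< p 1<p j<i) (∣⇒≤ {{m^n≢0 p j}} p^i∣p^j)
    where
    1<p : 1 < p
    1<p = nonTrivial⇒n>1 p {{prime⇒nonTrivial p-prime}}

  ^-injective : ∀ {i j} → p ^ i ≡ p ^ j → i ≡ j
  ^-injective eq = ≤-antisym (p^i∣p^j⇒i≤j (∣-reflexive eq)) (p^i∣p^j⇒i≤j (∣-reflexive (sym eq)))

  vprod∣p^n⇒≡map-p^ : ∀ {n} (c : Vec ℕ l) → vprod c ∣ p ^ n → ∃[ b ] c ≡ map (p ^_) b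
  vprod∣p^n⇒≡map-p^ []      _ = [] , refl
  vprod∣p^n⇒≡map-p^ {n = n} (x ∷ c) xc∣p^n
    with ∣p^n⇒≡p^i n (m*n∣⇒m∣ x (vprod c) xc∣p^n)
       | vprod∣p^n⇒≡map-p^ {n = n} c (m*n∣⇒n∣ x (vprod c) xc∣p^n)
  ... | i , refl | b , refl = i ∷ b , refl

vprod-map-^ : ∀ p (b : Vec ℕ l) → vprod (map (p ^_) b) ≡ p ^ sum b
vprod-map-^ p []      = refl
vprod-map-^ p (x ∷ b) = trans (cong (p ^ x *_) (vprod-map-^ p b)) (sym (^-distribˡ-+-* p x (sum b)))

sum-∷ʳ : ∀ (xs : Vec ℕ l) x → sum (xs ∷ʳ x) ≡ sum xs + x
sum-∷ʳ []       x = +-comm x 0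
sum-∷ʳ (y ∷ xs) x = trans (cong (y +_) (sum-∷ʳ xs x)) (sym (+-assoc y (sum xs) x))

div≡/ : ∀ m n .{{_ : NonZero n}} → m div n ≡ m / n
div≡/ m (suc n) = refl

p^i*p^j-div-p^o≡p^[i+j∸o] : ∀ p .{{_ : NonZero p}} {i j o} → o ≤ i →
                            (p ^ i * p ^ j) div (p ^ o) ≡ p ^ (i + j ∸ o)
p^i*p^j-div-p^o≡p^[i+j∸o] p {i} {j} {o} o≤i = begin
  (p ^ i * p ^ j) div (p ^ o)            ≡⟨ div≡/ _ (p ^ o) ⟩
  (p ^ i * p ^ j) / p ^ o                ≡⟨ cong (_/ p ^ o) split ⟩
  (p ^ (i + j ∸ o) * p ^ o) / p ^ o      ≡⟨ m*n/n≡m (p ^ (i + j ∸ o)) (p ^ o) ⟩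
  p ^ (i + j ∸ o)                        ∎
  where
  open ≡-Reasoning
  instance
    p^o≢0 : NonZero (p ^ o)
    p^o≢0 = m^n≢0 p o
  split : p ^ i * p ^ j ≡ p ^ (i + j ∸ o) * p ^ o
  split = begin
    p ^ i * p ^ j          ≡⟨ ^-distribˡ-+-* p i j ⟨
    p ^ (i + j)            ≡⟨ cong (p ^_) (m∸n+n≡m (≤-trans o≤i (m≤m+n i j))) ⟨
    p ^ (i + j ∸ o + o)    ≡⟨ ^-distribˡ-+-* p (i + j ∸ o) o ⟩
    p ^ (i + j ∸ o) * p ^ o ∎

module _ {a} {A : Set a} where
  lookup-∷ʳ-inject₁ : ∀ (xs : Vec A l) x i → lookup (xs ∷ʳ x) (inject₁ i) ≡ lookup xs i
  lookup-∷ʳ-inject₁ (y ∷ xs) x fzero    = refl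
  lookup-∷ʳ-inject₁ (y ∷ xs) x (fsuc i) = lookup-∷ʳ-inject₁ xs x i

  lookup-∷ʳ-fromℕ : ∀ (xs : Vec A l) x → lookup (xs ∷ʳ x) (fromℕ l) ≡ x
  lookup-∷ʳ-fromℕ []       x = refl
  lookup-∷ʳ-fromℕ (y ∷ xs) x = lookup-∷ʳ-fromℕ xs x

  lookup-∷ʳ-prevIdx : ∀ (xs : Vec A (suc l)) x i →
                      lookup (xs ∷ʳ x) (prevIdx i) ≡ lookup (x ∷ xs) (inject₁ i)
  lookup-∷ʳ-prevIdx xs x fzero    = lookup-∷ʳ-fromℕ xs x
  lookup-∷ʳ-prevIdx xs x (fsuc i) = lookup-∷ʳ-inject₁ xs x (inject₁ i)

  lookup-map-∷ʳ-inject₁ : ∀ {b} {B : Set b} (f : A → B) (xs : Vec A l) x i →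
                          lookup (map f (xs ∷ʳ x)) (inject₁ i) ≡ f (lookup xs i)
  lookup-map-∷ʳ-inject₁ f xs x i =
    trans (lookup-map (inject₁ i) f (xs ∷ʳ x)) (cong f (lookup-∷ʳ-inject₁ xs x i))

  replicate-∷ʳ : ∀ n (x : A) → replicate n x ∷ʳ x ≡ x ∷ replicate n x
  replicate-∷ʳ zero    x = refl
  replicate-∷ʳ (suc n) x = cong (x ∷_) (replicate-∷ʳ n x)

-- Entry i is M_i + b_{i-1} ∸ b_i, the previous exponent being threaded through the recursion;
-- see shifted-map-^, where the recursion starts from the last exponent bₙ.
shiftedExp : ℕ → Vec ℕ l → Vec ℕ l → Vec ℕ l
shiftedExp b₀ []       []       = []
shiftedExp b₀ (m ∷ ms) (b ∷ bs) = m + b₀ ∸ b ∷ shiftedExp b ms bs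

lookup-shiftedExp : ∀ b₀ (ms bs : Vec ℕ (suc l)) i →
  lookup (shiftedExp b₀ ms bs) i ≡ lookup ms i + lookup (b₀ ∷ bs) (inject₁ i) ∸ lookup bs i
lookup-shiftedExp b₀ (m ∷ ms)     (b ∷ bs)     fzero    = refl
lookup-shiftedExp b₀ (m ∷ m′ ∷ ms) (b ∷ b′ ∷ bs) (fsuc i) = lookup-shiftedExp b (m′ ∷ ms) (b′ ∷ bs) i

shiftedExp-self : ∀ b₀ (xs : Vec ℕ l) x → shiftedExp b₀ (xs ∷ʳ x) (xs ∷ʳ x) ≡ b₀ ∷ xs
shiftedExp-self b₀ []       x = cong (_∷ []) (m+n∸m≡n x b₀)
shiftedExp-self b₀ (y ∷ xs) x = cong₂ _∷_ (m+n∸m≡n y b₀) (shiftedExp-self y xs x)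

shifted-map-^ : ∀ p .{{_ : NonZero p}} {k} (M bs : Vec ℕ (suc k)) bₙ → (∀ i → lookup bs i ≤ lookup M i) →
  shifted (map (p ^_) M) (map (p ^_) (bs ∷ʳ bₙ)) ≡ map (p ^_) (shiftedExp bₙ M bs)
shifted-map-^ p {k} M bs bₙ bs≤M = trans (tabulate-cong entry) (tabulate∘lookup _)
  where
  open ≡-Reasoning
  c : Vec ℕ (suc (suc k))
  c = map (p ^_) (bs ∷ʳ bₙ)
  e : Vec ℕ (suc k)
  e = shiftedExp bₙ M bs
  entry : ∀ i → (lookup (map (p ^_) M) i * lookup c (prevIdx i)) div lookup c (inject₁ i)
              ≡ lookup (map (p ^_) e) i
  entry i = begin
    (lookup (map (p ^_) M) i * lookup c (prevIdx i)) div lookup c (inject₁ i)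
      ≡⟨ cong₂ _div_
           (cong₂ _*_ (lookup-map i (p ^_) M)
                      (trans (lookup-map (prevIdx i) (p ^_) (bs ∷ʳ bₙ))
                             (cong (p ^_) (lookup-∷ʳ-prevIdx bs bₙ i))))
           (lookup-map-∷ʳ-inject₁ (p ^_) bs bₙ i) ⟩
    (p ^ lookup M i * p ^ lookup (bₙ ∷ bs) (inject₁ i)) div (p ^ lookup bs i)
      ≡⟨ p^i*p^j-div-p^o≡p^[i+j∸o] p (bs≤M i) ⟩
    p ^ (lookup M i + lookup (bₙ ∷ bs) (inject₁ i) ∸ lookup bs i)
      ≡⟨ cong (p ^_) (lookup-shiftedExp bₙ M bs i) ⟨
    p ^ lookup e i
      ≡⟨ lookup-map i (p ^_) e ⟨
    lookup (map (p ^_) e) i ∎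

infix 4 _<colex_
_<colex_ : Rel (Vec ℕ l) 0ℓ
_<colex_ {zero}  _ _ = ⊥
_<colex_ {suc l} = ×-Lex _≡_ _<colex_ _<_ on λ v → tail v , head v

colex-wellFounded : WellFounded (_<colex_ {l})
colex-wellFounded {zero}  _ = acc λ ()
colex-wellFounded {suc l} = On.wellFounded (λ v → tail v , head v) (×-wellFounded colex-wellFounded <-wellFounded)

∷ʳ0-<colex : ∀ x (xs : Vec ℕ l) → x ∷ xs ≡ replicate (suc l) 0 ⊎ xs ∷ʳ 0 <colex x ∷ xs
∷ʳ0-<colex zero    []       = inj₁ refl
∷ʳ0-<colex (suc x) []       = inj₂ (inj₂ (refl , z<s))
∷ʳ0-<colex x       (y ∷ xs) with ∷ʳ0-<colex y xs
... | inj₂ lt = inj₂ (inj₁ lt)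
∷ʳ0-<colex zero    (_ ∷ xs) | inj₁ refl = inj₁ refl
∷ʳ0-<colex (suc x) (_ ∷ xs) | inj₁ refl = inj₂ (inj₂ (replicate-∷ʳ _ 0 , z<s))

shiftedExp-<colex : ∀ b₀ (ms : Vec ℕ l) bs → (∀ i → lookup bs i ≤ lookup (ms ∷ʳ 0) i) →
  bs ≡ ms ∷ʳ 0 ⊎ tail (shiftedExp b₀ (ms ∷ʳ 0) bs) <colex ms
shiftedExp-<colex b₀ []       (b ∷ []) bs≤ = inj₁ (cong (_∷ []) (n≤0⇒n≡0 (bs≤ fzero)))
shiftedExp-<colex b₀ (m ∷ ms) (b ∷ bs) bs≤ with shiftedExp-<colex b ms bs (bs≤ ∘ fsuc)
... | inj₂ lt = inj₂ (inj₁ lt)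
... | inj₁ refl with m≤n⇒m<n∨m≡n (bs≤ fzero)
...   | inj₂ refl = inj₁ refl
...   | inj₁ b<m rewrite shiftedExp-self b ms 0 = inj₂ (inj₂ (refl , b<m))

∣⇒∈map-suc-upTo : ∀ {m n} .{{_ : NonZero n}} → m ∣ n → m ∈ List.map suc (upTo n)
∣⇒∈map-suc-upTo {zero}  {n} 0∣n = contradiction (0∣⇒≡0 0∣n) (≢-nonZero⁻¹ n)
∣⇒∈map-suc-upTo {suc m}     m∣n = ∈-map⁺ suc (∈-upTo⁺ (∣⇒≤ m∣n))

vprod∣⇒∈-vecs : ∀ {m} .{{_ : NonZero m}} (c : Vec ℕ l) → vprod c ∣ m → c ∈ vecs l m
vprod∣⇒∈-vecs []      _     = here refl
vprod∣⇒∈-vecs (x ∷ c) xc∣m =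
  ∈-concat⁺′ (∈-map⁺ (x ∷_) (vprod∣⇒∈-vecs c (m*n∣⇒n∣ x (vprod c) xc∣m)))
             (∈-map⁺ _ (∣⇒∈map-suc-upTo (m*n∣⇒m∣ x (vprod c) xc∣m)))

vecs-unique : ∀ l m → Unique (vecs l m)
vecs-unique zero    m = All.[] AllPairs.∷ AllPairs.[]
vecs-unique (suc l) m = Unique.concat⁺
  (All.map⁺ (All.universal (λ _ → Unique.map⁺ ∷-injectiveʳ (vecs-unique l m)) _))
  (AllPairs.map⁺ (AllPairs.map disjoint (Unique.map⁺ suc-injective (Unique.upTo⁺ m))))
  where
  disjoint : ∀ {x y} → x ≢ y → Disjoint (List.map (x ∷_) (vecs l m)) (List.map (y ∷_) (vecs l m))
  disjoint x≢y (v∈ , v∈′) with ∈-map⁻ (_ ∷_) v∈ | ∈-map⁻ (_ ∷_) v∈′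
  ... | _ , _ , refl | _ , _ , eq = x≢y (∷-injectiveˡ eq)

module HeckeTerms {p} (p-prime : Prime p) {k} (K₁ : ℕ) (K′ : Vec ℕ k) where
  M : Vec ℕ (suc k)
  M = K′ ∷ʳ 0

  a : ℕ
  a = sum (M ∷ʳ K₁)

  m : ℕ
  m = p ^ a

  ms : Vec ℕ (suc k)
  ms = map (p ^_) M

  terms : List (Vec ℕ (suc (suc k)))
  terms = filter (heckeCond? k m ms) (vecs (suc (suc k)) m)

  c* : Vec ℕ (suc (suc k))
  c* = map (p ^_) (M ∷ʳ K₁)

  private instance
    p≢0 : NonZero p
    p≢0 = prime⇒nonZero p-prime
    m≢0 : NonZero m
    m≢0 = m^n≢0 p a

  1≤m : 1 ≤ m
  1≤m = m^n>0 p a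

  1≤ms : ∀ i → 1 ≤ lookup ms i
  1≤ms i = subst (1 ≤_) (sym (lookup-map i (p ^_) M)) (m^n>0 p (lookup M i))

  terms-unique : Unique terms
  terms-unique = Unique.filter⁺ (heckeCond? k m ms) {vecs (suc (suc k)) m} (vecs-unique (suc (suc k)) m)

  c*-cond : HeckeCond k m ms c*
  c*-cond = vprod-map-^ p (M ∷ʳ K₁)
          , λ i → ∣-reflexive (trans (lookup-map-∷ʳ-inject₁ (p ^_) M K₁ i) (sym (lookup-map i (p ^_) M)))

  c*∈terms : c* ∈ terms
  c*∈terms = ∈-filter⁺ (heckeCond? k m ms) (vprod∣⇒∈-vecs c* (∣-reflexive (proj₁ c*-cond))) c*-cond

  shifted-c* : shifted ms c* ≡ map (p ^_) (K₁ ∷ K′)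
  shifted-c* = trans (shifted-map-^ p M M K₁ (λ _ → ≤-refl)) (cong (map (p ^_)) (shiftedExp-self K₁ K′ 0))

  exponents-≤ : ∀ bs bₙ → (∀ i → lookup (map (p ^_) (bs ∷ʳ bₙ)) (inject₁ i) ∣ lookup ms i) →
                ∀ i → lookup bs i ≤ lookup M i
  exponents-≤ bs bₙ c∣ms i =
    p^i∣p^j⇒i≤j p-prime
      (subst₂ _∣_ (lookup-map-∷ʳ-inject₁ (p ^_) bs bₙ i) (lookup-map i (p ^_) M) (c∣ms i))

  last-exponent : ∀ bₙ → vprod (map (p ^_) (M ∷ʳ bₙ)) ≡ m → bₙ ≡ K₁
  last-exponent bₙ ∏≡m = +-cancelˡ-≡ (sum M) bₙ K₁ (begin
    sum M + bₙ      ≡⟨ sum-∷ʳ M bₙ ⟨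
    sum (M ∷ʳ bₙ)   ≡⟨ ^-injective p-prime (trans (sym (vprod-map-^ p (M ∷ʳ bₙ))) ∏≡m) ⟩
    sum (M ∷ʳ K₁)   ≡⟨ sum-∷ʳ M K₁ ⟩
    sum M + K₁      ∎)
    where open ≡-Reasoning

  classify : ∀ {c} → c ∈ terms → c ≡ c* ⊎ ∃[ e ] e <colex K₁ ∷ K′ × shifted ms c ≡ map (p ^_) e
  classify {c} c∈terms with proj₂ (∈-filter⁻ (heckeCond? k m ms) {xs = vecs (suc (suc k)) m} c∈terms)
  ... | ∏c≡m , c∣ms with vprod∣p^n⇒≡map-p^ p-prime {n = a} c (∣-reflexive ∏c≡m)
  ... | b , refl with initLast b
  ... | bs , bₙ , refl with shiftedExp-<colex bₙ K′ bs (exponents-≤ bs bₙ c∣ms)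
  ...   | inj₁ refl = inj₁ (cong (λ x → map (p ^_) (M ∷ʳ x)) (last-exponent bₙ ∏c≡m))
  ...   | inj₂ lt   = inj₂ (shiftedExp bₙ M bs , inj₁ lt , shifted-map-^ p M bs bₙ (exponents-≤ bs bₙ c∣ms))

module HeckeEigenvalues {c ℓ} (R : CommutativeRing c ℓ) (k : ℕ)
                        (A : Vec ℕ (suc k) → CommutativeRing.Carrier R) (p : ℕ) where
  open CommutativeRing R
    renaming (_+_ to _+ᴿ_; _*_ to _*ᴿ_; _-_ to _-ᴿ_; refl to ≈-refl; sym to ≈-sym; trans to ≈-trans)
  open import Algebra.Properties.Ring ring using (-1*x≈-x)
  open import Algebra.Properties.CommutativeSemigroup +-commutativeSemigroup using (x∙yz≈y∙xz)
  open import Relation.Binary.Reasoning.Setoid setoid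

  private
    ℋ* : Carrier → Set ℓ
    ℋ* = InHp* R k A p

  InHp*-resp : ∀ {x y} → x ≈ y → ℋ* x → ℋ* y
  InHp*-resp x≈y (T , Tφ≈x) = T , ≈-trans Tφ≈x x≈y

  InHp*-0# : ℋ* 0#
  InHp*-0# = con (ℤ.+ 0) , ≈-refl

  InHp*-1# : ℋ* 1#
  InHp*-1# = con (ℤ.+ 1) , +-identityʳ 1#

  InHp*-T : ∀ j → ℋ* (A (first k (p ^ j)))
  InHp*-T j = gen j , ≈-refl

  InHp*-add : ∀ {x y} → ℋ* x → ℋ* y → ℋ* (x +ᴿ y)
  InHp*-add (T , Tφ≈x) (U , Uφ≈y) = T ⊕ U , +-cong Tφ≈x Uφ≈y

  InHp*-mul : ∀ {x y} → ℋ* x → ℋ* y → ℋ* (x *ᴿ y)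
  InHp*-mul (T , Tφ≈x) (U , Uφ≈y) = T ⊗ U , *-cong Tφ≈x Uφ≈y

  InHp*-sub : ∀ {x y} → ℋ* x → ℋ* y → ℋ* (x -ᴿ y)
  InHp*-sub {y = y} x∈ (U , Uφ≈y) = InHp*-add x∈
    (con ℤ.-[1+ 0 ] ⊗ U , ≈-trans (*-cong (-‿cong (+-identityʳ 1#)) Uφ≈y) (-1*x≈-x y))

  InHp*-rsum : ∀ {B : Set} (F : B → Carrier) {xs} → (∀ {x} → x ∈ xs → ℋ* (F x)) →
               ℋ* (rsum R (List.map F xs))
  InHp*-rsum F {[]}     _   = InHp*-0#
  InHp*-rsum F {x ∷ xs} all = InHp*-add (all (here refl)) (InHp*-rsum F (all ∘ there))

  rsum-split : ∀ {B : Set} (F : B → Carrier) {v xs} → Unique xs → v ∈ xs →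
               (∀ {x} → x ∈ xs → x ≢ v → ℋ* (F x)) →
               ∃[ h ] ℋ* h × rsum R (List.map F xs) ≈ F v +ᴿ h
  rsum-split F {xs = x ∷ xs} (x∉xs AllPairs.∷ _) (here refl) others =
    rsum R (List.map F xs)
    , InHp*-rsum F (λ y∈xs → others (there y∈xs) (≢-sym (All.lookup x∉xs y∈xs)))
    , ≈-refl
  rsum-split F {v} {x ∷ xs} (x∉xs AllPairs.∷ xs!) (there v∈xs) others =
    let h , h∈ , Σxs≈ = rsum-split F xs! v∈xs (others ∘ there) in
    F x +ᴿ h , InHp*-add (others (here refl) (All.lookup x∉xs v∈xs)) h∈ , (begin
      F x +ᴿ rsum R (List.map F xs)  ≈⟨ +-congˡ Σxs≈ ⟩
      F x +ᴿ (F v +ᴿ h)              ≈⟨ x∙yz≈y∙xz (F x) (F v) h ⟩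
      F v +ᴿ (F x +ᴿ h)              ∎)

  module _ (hecke : HeckeRelation R k A) (p-prime : Prime p) where
    open import Algebra.Properties.Group +-group using (x≈z//y)

    InHp*-step : ∀ K₁ (K′ : Vec ℕ k) → ℋ* (A (map (p ^_) (K′ ∷ʳ 0))) →
                 (∀ {e} → e <colex K₁ ∷ K′ → ℋ* (A (map (p ^_) e))) → ℋ* (A (map (p ^_) (K₁ ∷ K′)))
    InHp*-step K₁ K′ A[ms]∈ ih =
      let h , h∈ , Σ≈ = rsum-split F terms-unique c*∈terms others
      in InHp*-resp (A[p^K]≈ Σ≈) (InHp*-sub (InHp*-mul (InHp*-T a) A[ms]∈) h∈)
      where
      open HeckeTerms p-prime K₁ K′
      F : Vec ℕ (suc (suc k)) → Carrier
      F c = A (shifted ms c)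
      others : ∀ {c} → c ∈ terms → c ≢ c* → ℋ* (F c)
      others c∈ c≢c* with classify c∈
      ... | inj₁ c≡c*            = contradiction c≡c* c≢c*
      ... | inj₂ (e , e<K , c↦e) = InHp*-resp (reflexive (cong A (sym c↦e))) (ih e<K)
      A[p^K]≈ : ∀ {h} → rsum R (List.map F terms) ≈ F c* +ᴿ h →
                A (first k m) *ᴿ A ms -ᴿ h ≈ A (map (p ^_) (K₁ ∷ K′))
      A[p^K]≈ {h} Σ≈ = begin
        A (first k m) *ᴿ A ms -ᴿ h  ≈⟨ x≈z//y (F c*) h _ (≈-sym (≈-trans (hecke m ms 1≤m 1≤ms) Σ≈)) ⟨
        F c*                        ≡⟨ cong A shifted-c* ⟩
        A (map (p ^_) (K₁ ∷ K′))    ∎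

proposition2p3 : {c ℓ : Level} (R : CommutativeRing c ℓ) (k : ℕ)
    (A : Vec ℕ (suc k) → CommutativeRing.Carrier R) →
    HeckeRelation R k A →
    CommutativeRing._≈_ R (A (replicate (suc k) 1)) (CommutativeRing.1# R) →
    (p : ℕ) → Prime p → (K : Vec ℕ (suc k)) →
    InHp* R k A p (A (map (p ^_) K))
proposition2p3 R k A hecke A[1]≈1 p p-prime =
  WF.All.wfRec colex-wellFounded _ (λ K → InHp* R k A p (A (map (p ^_) K))) step
  where
  open CommutativeRing R using (reflexive) renaming (sym to ≈-sym; trans to ≈-trans)
  open HeckeEigenvalues R k A p
  step : ∀ K → (∀ {e} → e <colex K → InHp* R k A p (A (map (p ^_) e))) → InHp* R k A p (A (map (p ^_) K))
  step (K₁ ∷ K′) ih with ∷ʳ0-<colex K₁ K′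
  ... | inj₁ refl =
    InHp*-resp (≈-sym (≈-trans (reflexive (cong A (map-replicate (p ^_) 0 (suc k)))) A[1]≈1)) InHp*-1#
  ... | inj₂ M<K  = InHp*-step hecke p-prime K₁ K′ (ih M<K) ih
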